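{- For every integer $m\geq 2$, the windmill graph $K_6^{(m)}$ is total prime.
   Context: All graphs are finite and simple. For a graph $G$ with vertex set $V$ and edge set $E$, a total prime labeling is a bijection $\ell: V\cup E\to\{1,2,\ldots,|V|+|E|\}$ such that (i) for every pair of adjacent vertices $u,v$, $\gcd(\ell(u),\ell(v))=1$, and (ii) for every vertex $v$ of degree at least 2, the greatest common divisor of the labels $\ell(uv)$ over all edges $uv$ incident to $v$ equals 1. A graph is total prime if it admits a total prime labeling. The windmill graph $K_n^{(m)}$ consists of $m$ copies of the complete graph $K_n$ that share exactly one common vertex and are otherwise vertex-disjoint. -}

module Defs where

open import Data.Nat using (ℕ; zero; suc; _+_; _*_; _/_; pred; _≡ᵇ_)
open import Data.Nat.Divisibility using (_∣_)
open import Data.Nat.Coprimality using (Coprime)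
open import Data.Bool using (Bool; true; false; T; not; _∧_; _∨_)
open import Data.Fin using (Fin; toℕ; _<_)
open import Data.Fin.Properties using () renaming (_≟_ to _≟ᶠ_)
open import Data.Bool.Properties using (∨-comm)
open import Relation.Binary.PropositionalEquality using (refl; cong; cong₂) renaming (sym to ≡-sym)
open import Relation.Nullary using (yes; no)
open import Data.Nat.Properties using (≡ᵇ⇒≡; ≡⇒≡ᵇ)
open import Data.Product using (Σ; Σ-syntax; ∃; ∃-syntax; _×_; _,_; proj₁; proj₂)
open import Data.Sum using (_⊎_; inj₁; inj₂)
open import Function.Bundles using (_⤖_; Bijection)
open import Relation.Binary.PropositionalEquality using (_≡_; _≢_)
open import Relation.Nullary.Decidable using (⌊_⌋)
import Data.Empty

record SimpleGraph (n : ℕ) : Set where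
  field
    adj   : Fin n → Fin n → Bool
    adj-sym : ∀ i j → adj i j ≡ adj j i
    irref : ∀ i → adj i i ≡ false

open SimpleGraph public

-- Edges: unordered pairs {i , j}, represented canonically with i < j.
Edge : ∀ {n} → SimpleGraph n → Set
Edge {n} G = Σ[ i ∈ Fin n ] Σ[ j ∈ Fin n ] (i < j × T (adj G i j))

IncidentTo : ∀ {n} {G : SimpleGraph n} → Edge G → Fin n → Set
IncidentTo (i , j , _) v = (i ≡ v) ⊎ (j ≡ v)

DegreeAtLeast2 : ∀ {n} (G : SimpleGraph n) → Fin n → Set
DegreeAtLeast2 G v =
  Σ[ e₁ ∈ Edge G ] Σ[ e₂ ∈ Edge G ] (e₁ ≢ e₂ × IncidentTo {G = G} e₁ v × IncidentTo {G = G} e₂ v)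

-- A total prime labeling: a bijection from V ⊎ E onto Fin N (which forces
-- N = |V| + |E|); the label of x is 1 + toℕ (f x) ∈ {1, …, N}.
record TotalPrimeLabeling {n} (G : SimpleGraph n) : Set where
  field
    N   : ℕ
    lab : (Fin n ⊎ Edge G) ⤖ Fin N
  label : Fin n ⊎ Edge G → ℕ
  label x = suc (toℕ (Bijection.to lab x))
  field
    vertexCond : ∀ u v → T (adj G u v) → Coprime (label (inj₁ u)) (label (inj₁ v))
    -- (ii) at each vertex of degree ≥ 2, the gcd of incident edge labels is 1,
    --      i.e. every common divisor of these labels equals 1
    edgeCond : ∀ v → DegreeAtLeast2 G v →
      ∀ d → (∀ (e : Edge G) → IncidentTo {G = G} e v → d ∣ label (inj₂ e)) → d ≡ 1

TotalPrime : ∀ {n} → SimpleGraph n → Set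
TotalPrime G = TotalPrimeLabeling G

-- Windmill graph K_{k+2}^{(m)}: vertex 0 is the common centre; vertex
-- 1 + t (t < m * (k+1)) lies in blade t / (k+1).
isZero : ℕ → Bool
isZero zero = true
isZero (suc _) = false

blade : (k : ℕ) → ℕ → ℕ
blade k v = pred v / suc k

windmillAdj : (k m : ℕ) → Fin (suc (m * suc k)) → Fin (suc (m * suc k)) → Bool
windmillAdj k m i j =
  not ⌊ i ≟ᶠ j ⌋ ∧ (isZero (toℕ i) ∨ (isZero (toℕ j) ∨ (blade k (toℕ i) ≡ᵇ blade k (toℕ j))))

private
  ≡ᵇ-sym : ∀ a b → (a ≡ᵇ b) ≡ (b ≡ᵇ a)
  ≡ᵇ-sym zero zero = refl
  ≡ᵇ-sym zero (suc b) = refl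
  ≡ᵇ-sym (suc a) zero = refl
  ≡ᵇ-sym (suc a) (suc b) = ≡ᵇ-sym a b

  neq-sym : ∀ {n} (i j : Fin n) → not ⌊ i ≟ᶠ j ⌋ ≡ not ⌊ j ≟ᶠ i ⌋
  neq-sym i j with i ≟ᶠ j | j ≟ᶠ i
  ... | yes _ | yes _ = refl
  ... | no _ | no _ = refl
  ... | yes p | no q = Data.Empty.⊥-elim (q (≡-sym p))
  ... | no p | yes q = Data.Empty.⊥-elim (p (≡-sym q))

  ∨-shuffle : ∀ a b c d → c ≡ d → (a ∨ (b ∨ c)) ≡ (b ∨ (a ∨ d))
  ∨-shuffle false b c d refl = refl
  ∨-shuffle true false c d refl = refl
  ∨-shuffle true true c d refl = refl

  self-false : ∀ {n} (i : Fin n) → not ⌊ i ≟ᶠ i ⌋ ≡ false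
  self-false i with i ≟ᶠ i
  ... | yes _ = refl
  ... | no p = Data.Empty.⊥-elim (p refl)

windmill : (k m : ℕ) → SimpleGraph (suc (m * suc k))
windmill k m = record
  { adj = windmillAdj k m
  ; adj-sym = λ i j → cong₂ _∧_ (neq-sym i j)
      (∨-shuffle (isZero (toℕ i)) (isZero (toℕ j)) _ _ (≡ᵇ-sym (blade k (toℕ i)) (blade k (toℕ j))))
  ; irref = λ i → cong (_∧ (isZero (toℕ i) ∨ (isZero (toℕ i) ∨ (blade k (toℕ i) ≡ᵇ blade k (toℕ i))))) (self-false i)
  }

-- Give the centre the label 1 and blade b (counted from 0) the twenty consecutive labels
-- 20b + 2, …, 20b + 21, spread over its five outer vertices and fifteen edges.  Writing
-- b = 3q + r, these labels are 60q + x with x ∈ {20r + 2, …, 20r + 21}, and 60q + x, 60q + y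
-- are coprime whenever x, y are coprime and |x − y| divides 60.  So it suffices to fix one
-- distribution for each residue r of b mod 3 in which the five outer vertex labels are
-- pairwise coprime in this strong sense, and every vertex of the blade's K₆ lies on two edges
-- whose labels are.  The three distributions are finite tables checked by computation.
module Submission where

open import Data.Bool using (T)
open import Data.Bool.Properties using (T-∧; T-irrelevant)
open import Data.Fin using (Fin; zero; suc; toℕ; _<_; combine; quotient; remainder; #_)
open import Data.Fin.Permutation using (permutation)
open import Data.Fin.Properties
  using ( +↔⊎; *↔×; toℕ-combine; combine-remQuot; remQuot-combine; toℕ-injective; toℕ<n
        ; <-irrelevant; <⇒≢; all?; any?)
  renaming (_≟_ to _≟ᶠ_)
open import Data.Nat as ℕ using (ℕ; zero; suc; _+_; _*_; _∸_; _/_; _≤_; ∣_-_∣; z≤n; s≤s; NonZero)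
open import Data.Nat.Coprimality using (Coprime; coprime?; 1-coprimeTo) renaming (sym to coprime-sym)
open import Data.Nat.DivMod using (_mod_; _divMod_; DivMod; m*n/n≡m; m<n⇒m/n≡0; +-distrib-/-∣ˡ)
open import Data.Nat.Divisibility using (_∣_; _∣?_; ∣-trans; ∣m+n∣m⇒∣n; m∣m*n; divides-refl)
open import Data.Nat.Properties
  using ( ≤-total; m+[n∸m]≡n; m≤n⇒∣m-n∣≡n∸m; m≤n⇒∣n-m∣≡n∸m; ∣m+n-m+o∣≡∣n-o∣; *-comm; +-identityʳ
        ; +-cancelˡ-<; +-monoʳ-<; ≡ᵇ⇒≡; ≡⇒≡ᵇ)
open import Data.Nat.Tactic.RingSolver using (solve-∀)
open import Data.Product using (Σ-syntax; ∃₂; _×_; _,_; proj₁; proj₂; uncurry)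
open import Data.Product.Algebra using (×-distribˡ-⊎)
open import Data.Sum using (_⊎_; inj₁; inj₂; map; map₂)
open import Data.Sum.Algebra using (⊎-cong; ⊎-assoc)
open import Data.Vec using (Vec; []; _∷_; lookup)
open import Function using (_∘_)
open import Function.Bundles using (_↔_; Inverse; Equivalence; mk↔ₛ′)
open import Function.Properties.Inverse using (↔-refl; ↔-sym; ↔-trans; ↔⇒⤖)
open import Level using (0ℓ)
open import Relation.Binary.PropositionalEquality
  using (_≡_; _≢_; refl; sym; trans; cong; cong₂; subst; subst₂; module ≡-Reasoning)
open import Relation.Nullary.Decidable
  using (Dec; toWitness; fromWitnessFalse; toWitnessFalse; ¬?; _×-dec_; _⊎-dec_; _→-dec_)

open import Defs

open Inverse using (to; from)

∣m∣n⇒∣n∸m : ∀ {d m n} → m ≤ n → d ∣ m → d ∣ n → d ∣ n ∸ m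
∣m∣n⇒∣n∸m {d} m≤n d∣m d∣n = ∣m+n∣m⇒∣n (subst (d ∣_) (sym (m+[n∸m]≡n m≤n)) d∣n) d∣m

∣m∣n⇒∣∣m-n∣ : ∀ {d m n} → d ∣ m → d ∣ n → d ∣ ∣ m - n ∣
∣m∣n⇒∣∣m-n∣ {d} {m} {n} d∣m d∣n with ≤-total m n
... | inj₁ m≤n = subst (d ∣_) (sym (m≤n⇒∣m-n∣≡n∸m m≤n)) (∣m∣n⇒∣n∸m m≤n d∣m d∣n)
... | inj₂ n≤m = subst (d ∣_) (sym (m≤n⇒∣n-m∣≡n∸m n≤m)) (∣m∣n⇒∣n∸m n≤m d∣n d∣m)

coprime-translate : ∀ c {a b} → ∣ a - b ∣ ∣ c → Coprime a b → Coprime (c + a) (c + b)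
coprime-translate c {a} {b} ∣a-b∣∣c a⊥b (d∣c+a , d∣c+b) =
  a⊥b (∣m+n∣m⇒∣n d∣c+a d∣c , ∣m+n∣m⇒∣n d∣c+b d∣c)
  where
  d∣c = ∣-trans (subst (_ ∣_) (∣m+n-m+o∣≡∣n-o∣ c a b) (∣m∣n⇒∣∣m-n∣ d∣c+a d∣c+b)) ∣a-b∣∣c

Pair : ℕ → Set
Pair n = Σ[ s ∈ Fin n ] Σ[ t ∈ Fin n ] s < t

Pair-≡ : ∀ {n} {p q : Pair n} → proj₁ p ≡ proj₁ q → proj₁ (proj₂ p) ≡ proj₁ (proj₂ q) → p ≡ q
Pair-≡ {p = s , t , s<t} {.s , .t , s<t′} refl refl = cong (λ x → s , t , x) (<-irrelevant s<t s<t′)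

PairIncidentTo : ∀ {n} → Pair n → Fin n → Set
PairIncidentTo (s , t , _) v = (s ≡ v) ⊎ (t ≡ v)

pairIncidentTo? : ∀ {n} (p : Pair n) v → Dec (PairIncidentTo p v)
pairIncidentTo? (s , t , _) v = (s ≟ᶠ v) ⊎-dec (t ≟ᶠ v)

pairCount : ℕ → ℕ
pairCount zero    = 0
pairCount (suc n) = n + pairCount n

Pair-suc↔ : ∀ {n} → Pair (suc n) ↔ (Fin n ⊎ Pair n)
Pair-suc↔ = mk↔ₛ′ split join split-join join-split
  where
  split : ∀ {n} → Pair (suc n) → Fin n ⊎ Pair n
  split (zero  , suc t , _)       = inj₁ t
  split (suc s , suc t , s≤s s<t) = inj₂ (s , t , s<t)

  join : ∀ {n} → Fin n ⊎ Pair n → Pair (suc n)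
  join (inj₁ t)             = zero , suc t , s≤s z≤n
  join (inj₂ (s , t , s<t)) = suc s , suc t , s≤s s<t

  split-join : ∀ {n} (x : Fin n ⊎ Pair n) → split (join x) ≡ x
  split-join (inj₁ _) = refl
  split-join (inj₂ _) = refl

  join-split : ∀ {n} (p : Pair (suc n)) → join (split p) ≡ p
  join-split (zero  , suc _ , s≤s z≤n) = refl
  join-split (suc _ , suc _ , s≤s _)   = refl

Pair↔Fin : ∀ n → Pair n ↔ Fin (pairCount n)
Pair↔Fin zero    = mk↔ₛ′ (λ ()) (λ ()) (λ ()) (λ ())
Pair↔Fin (suc n) = ↔-trans Pair-suc↔ (↔-trans (⊎-cong ↔-refl (Pair↔Fin n)) (↔-sym +↔⊎))

Edge-≡ : ∀ {n} {G : SimpleGraph n} {e e′ : Edge G} →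
         proj₁ e ≡ proj₁ e′ → proj₁ (proj₂ e) ≡ proj₁ (proj₂ e′) → e ≡ e′
Edge-≡ {e = i , j , i<j , a} {.i , .j , i<j′ , a′} refl refl =
  cong₂ (λ x y → i , j , x , y) (<-irrelevant i<j i<j′) (T-irrelevant a a′)

fibrewise↔ : ∀ {I A B : Set} → (I → A ↔ B) → (I × A) ↔ (I × B)
fibrewise↔ f = mk↔ₛ′ (λ (i , a) → i , to (f i) a) (λ (i , b) → i , from (f i) b)
  (λ (i , b) → cong (i ,_) (Inverse.strictlyInverseˡ (f i) b))
  (λ (i , a) → cong (i ,_) (Inverse.strictlyInverseʳ (f i) a))

module _ {m n : ℕ} where

  combine-monoʳ-< : ∀ (b : Fin m) {s t : Fin n} → s < t → combine b s < combine b t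
  combine-monoʳ-< b {s} {t} s<t =
    subst₂ ℕ._<_ (sym (toℕ-combine b s)) (sym (toℕ-combine b t)) (+-monoʳ-< (n * toℕ b) s<t)

  combine-cancelʳ-< : ∀ (b : Fin m) {s t : Fin n} → combine b s < combine b t → s < t
  combine-cancelʳ-< b {s} {t} bs<bt =
    +-cancelˡ-< (n * toℕ b) _ _ (subst₂ ℕ._<_ (toℕ-combine b s) (toℕ-combine b t) bs<bt)

  toℕ-combine/n : .{{_ : NonZero n}} (b : Fin m) (s : Fin n) → toℕ (combine b s) / n ≡ toℕ b
  toℕ-combine/n b s = begin
    toℕ (combine b s) / n      ≡⟨ cong (_/ n) (toℕ-combine b s) ⟩
    (n * toℕ b + toℕ s) / n    ≡⟨ cong (λ x → (x + toℕ s) / n) (*-comm n (toℕ b)) ⟩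
    (toℕ b * n + toℕ s) / n    ≡⟨ +-distrib-/-∣ˡ (toℕ s) (divides-refl (toℕ b)) ⟩
    toℕ b * n / n + toℕ s / n  ≡⟨ cong₂ _+_ (m*n/n≡m (toℕ b) n) (m<n⇒m/n≡0 (toℕ<n s)) ⟩
    toℕ b + 0                  ≡⟨ +-identityʳ (toℕ b) ⟩
    toℕ b                      ∎
    where open ≡-Reasoning

  toℕ-quotient : .{{_ : NonZero n}} (i : Fin (m * n)) → toℕ (quotient {m} n i) ≡ toℕ i / n
  toℕ-quotient i = trans (sym (toℕ-combine/n _ _)) (cong (λ j → toℕ j / n) (combine-remQuot {m} n i))

  remainder-< : ∀ {i j : Fin (m * n)} →
                quotient {m} n i ≡ quotient {m} n j → i < j → remainder {m} n i < remainder {m} n j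
  remainder-< {i} {j} qi≡qj i<j = combine-cancelʳ-< (quotient {m} n i) (subst₂ _<_
    (sym (combine-remQuot {m} n i))
    (sym (trans (cong (λ q → combine q (remainder {m} n j)) qi≡qj) (combine-remQuot {m} n j)))
    i<j)

  centred↔ : Fin (suc (m * n)) ↔ (Fin 1 ⊎ Fin m × Fin n)
  centred↔ = ↔-trans +↔⊎ (⊎-cong ↔-refl *↔×)

-- Positions in a blade of K_{k+2}^{(m)} are Fin (2 + k), position zero being the shared
-- centre; a blade object is an outer position or a pair of positions.
BladeObject : ℕ → Set
BladeObject k = Fin (suc k) ⊎ Pair (2 + k)

module WindmillBlades (k m : ℕ) where

  bladeVertex : Fin m → Fin (2 + k) → Fin (suc (m * suc k))
  bladeVertex b zero    = zero
  bladeVertex b (suc s) = suc (combine b s)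

  adj-inner : ∀ {i j} → T (adj (windmill k m) (suc i) (suc j)) →
              suc i ≢ suc j × quotient {m} (suc k) i ≡ quotient {m} (suc k) j
  adj-inner {i} {j} a with Equivalence.to T-∧ a
  ... | i≢j , sameBlade = toWitnessFalse i≢j , toℕ-injective (begin
    toℕ (quotient {m} (suc k) i)  ≡⟨ toℕ-quotient {m} i ⟩
    toℕ i / suc k                 ≡⟨ ≡ᵇ⇒≡ _ _ sameBlade ⟩
    toℕ j / suc k                 ≡⟨ toℕ-quotient {m} j ⟨
    toℕ (quotient {m} (suc k) j)  ∎)
    where open ≡-Reasoning

  adj-bladeVertex : ∀ {b b′ s t} → T (adj (windmill k m) (bladeVertex b (suc s)) (bladeVertex b′ (suc t))) →
                    b ≡ b′ × s ≢ t
  adj-bladeVertex {b} {b′} {s} {t} a = b≡b′ , λ s≡t → proj₁ (adj-inner a) (cong suc (cong₂ combine b≡b′ s≡t))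
    where
    b≡b′ = trans (sym (cong proj₁ (remQuot-combine b s)))
                 (trans (proj₂ (adj-inner a)) (cong proj₁ (remQuot-combine b′ t)))

  bladeVertex-< : ∀ b {s t} → s < t → bladeVertex b s < bladeVertex b t
  bladeVertex-< b {zero}  {suc t} _         = s≤s z≤n
  bladeVertex-< b {suc s} {suc t} (s≤s s<t) = s≤s (combine-monoʳ-< b s<t)

  bladeVertex-adj : ∀ b {s t} → s < t → T (adj (windmill k m) (bladeVertex b s) (bladeVertex b t))
  bladeVertex-adj b {zero}  {suc t} _   = _
  bladeVertex-adj b {suc s} {suc t} s<t = Equivalence.from T-∧
    ( fromWitnessFalse (<⇒≢ (bladeVertex-< b s<t))
    , ≡⇒≡ᵇ _ _ (trans (toℕ-combine/n b s) (sym (toℕ-combine/n b t))))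

  data VertexView : Fin (suc (m * suc k)) → Set where
    centre : VertexView zero
    inner  : ∀ b s → VertexView (bladeVertex b (suc s))

  vertexView : ∀ v → VertexView v
  vertexView zero    = centre
  vertexView (suc v) = subst (VertexView ∘ suc) (combine-remQuot {m} (suc k) v) (inner _ _)

  bladeEdge : Fin m → Pair (2 + k) → Edge (windmill k m)
  bladeEdge b (s , t , s<t) = bladeVertex b s , bladeVertex b t , bladeVertex-< b s<t , bladeVertex-adj b s<t

  bladeEdge-incident : ∀ b p {s} → PairIncidentTo p s →
                       IncidentTo {G = windmill k m} (bladeEdge b p) (bladeVertex b s)
  bladeEdge-incident b p = map (cong (bladeVertex b)) (cong (bladeVertex b))

  edgeBlade : Edge (windmill k m) → Fin m × Pair (2 + k)
  edgeBlade (zero  , zero  , ()      , _)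
  edgeBlade (suc _ , zero  , ()      , _)
  edgeBlade (zero  , suc j , _       , _) =
    quotient {m} (suc k) j , zero , suc (remainder {m} (suc k) j) , s≤s z≤n
  edgeBlade (suc i , suc j , s≤s i<j , a) =
    quotient {m} (suc k) i , suc (remainder {m} (suc k) i) , suc (remainder {m} (suc k) j) ,
    s≤s (remainder-< {m} (proj₂ (adj-inner a)) i<j)

  edgeBlade-bladeEdge : ∀ b p → edgeBlade (bladeEdge b p) ≡ (b , p)
  edgeBlade-bladeEdge b (zero  , suc t , s≤s z≤n) =
    cong₂ _,_ (cong proj₁ (remQuot-combine b t)) (Pair-≡ refl (cong (suc ∘ proj₂) (remQuot-combine b t)))
  edgeBlade-bladeEdge b (suc s , suc t , s≤s _) =
    cong₂ _,_ (cong proj₁ (remQuot-combine b s))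
      (Pair-≡ (cong (suc ∘ proj₂) (remQuot-combine b s)) (cong (suc ∘ proj₂) (remQuot-combine b t)))

  bladeEdge-edgeBlade : ∀ e → uncurry bladeEdge (edgeBlade e) ≡ e
  bladeEdge-edgeBlade (zero  , zero  , ()    , _)
  bladeEdge-edgeBlade (suc _ , zero  , ()    , _)
  bladeEdge-edgeBlade (zero  , suc j , _     , _) =
    Edge-≡ {G = windmill k m} refl (cong suc (combine-remQuot {m} (suc k) j))
  bladeEdge-edgeBlade (suc i , suc j , s≤s _ , a) = Edge-≡ {G = windmill k m}
    (cong suc (combine-remQuot {m} (suc k) i))
    (cong suc (trans (cong (λ q → combine q (remainder {m} (suc k) j)) (proj₂ (adj-inner a)))
                     (combine-remQuot {m} (suc k) j)))

  Edge↔ : Edge (windmill k m) ↔ (Fin m × Pair (2 + k))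
  Edge↔ = mk↔ₛ′ edgeBlade (uncurry bladeEdge) (uncurry edgeBlade-bladeEdge) bladeEdge-edgeBlade

  bladeObject : Fin m → BladeObject k → Fin (suc (m * suc k)) ⊎ Edge (windmill k m)
  bladeObject b (inj₁ s) = inj₁ (bladeVertex b (suc s))
  bladeObject b (inj₂ p) = inj₂ (bladeEdge b p)

  objects↔ : (Fin (suc (m * suc k)) ⊎ Edge (windmill k m)) ↔ (Fin 1 ⊎ Fin m × BladeObject k)
  objects↔ = ↔-trans (⊎-cong centred↔ Edge↔)
    (↔-trans (⊎-assoc 0ℓ _ _ _) (⊎-cong (↔-refl {A = Fin 1}) (↔-sym (×-distribˡ-⊎ 0ℓ _ _ _))))

  objects↔-bladeObject : ∀ b o → to objects↔ (bladeObject b o) ≡ inj₂ (b , o)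
  objects↔-bladeObject b (inj₁ s) = Inverse.strictlyInverseˡ objects↔ (inj₂ (b , inj₁ s))
  objects↔-bladeObject b (inj₂ p) = Inverse.strictlyInverseˡ objects↔ (inj₂ (b , inj₂ p))

module BladeLabelling (k m L : ℕ) (slot : Fin (suc m) → BladeObject k ↔ Fin L) where

  open WindmillBlades k (suc m)

  bladeLabel : Fin (suc m) → BladeObject k → ℕ
  bladeLabel b o = 2 + (L * toℕ b + toℕ (to (slot b) o))

  -- The centre is sent to 0, so its label computes to 1.
  labelling : (Fin (suc (suc m * suc k)) ⊎ Edge (windmill k (suc m))) ↔ Fin (suc (suc m * L))
  labelling = ↔-trans objects↔ (↔-trans (⊎-cong ↔-refl (fibrewise↔ slot)) (↔-sym centred↔))

  label : Fin (suc (suc m * suc k)) ⊎ Edge (windmill k (suc m)) → ℕ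
  label x = suc (toℕ (to labelling x))

  label-bladeObject : ∀ b o → label (bladeObject b o) ≡ bladeLabel b o
  label-bladeObject b o = begin
    label (bladeObject b o)              ≡⟨ cong (suc ∘ toℕ ∘ from (centred↔ {suc m} {L}) ∘ map₂ (to (fibrewise↔ slot)))
                                               (objects↔-bladeObject b o) ⟩
    2 + toℕ (combine b (to (slot b) o))  ≡⟨ cong (2 +_) (toℕ-combine b _) ⟩
    bladeLabel b o                       ∎
    where open ≡-Reasoning

  windmill-totalPrime :
    (∀ b {s t} → s ≢ t → Coprime (bladeLabel b (inj₁ s)) (bladeLabel b (inj₁ t))) →
    (∀ b v → ∃₂ λ p q → PairIncidentTo p v × PairIncidentTo q v ×
                        Coprime (bladeLabel b (inj₂ p)) (bladeLabel b (inj₂ q))) →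
    TotalPrime (windmill k (suc m))
  windmill-totalPrime vertices-coprime edges-coprime = record
    { N = suc (suc m * L) ; lab = ↔⇒⤖ labelling ; vertexCond = vertexCond ; edgeCond = λ v _ → edgeCond v }
    where
    vertexCond : ∀ u v → T (adj (windmill k (suc m)) u v) → Coprime (label (inj₁ u)) (label (inj₁ v))
    vertexCond u v a with vertexView u | vertexView v
    ... | centre    | _          = 1-coprimeTo _
    ... | inner _ _ | centre     = coprime-sym (1-coprimeTo _)
    ... | inner b s | inner b′ t with adj-bladeVertex {b} {b′} {s} {t} a
    ... | refl , s≢t = subst₂ Coprime (sym (label-bladeObject b (inj₁ s))) (sym (label-bladeObject b (inj₁ t)))
                         (vertices-coprime b s≢t)

    position : ∀ v → ∃₂ λ b s → bladeVertex b s ≡ v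
    position v with vertexView v
    ... | centre    = zero , zero , refl
    ... | inner b s = b , suc s , refl

    edgeCond : ∀ v d → (∀ e → IncidentTo {G = windmill k (suc m)} e v → d ∣ label (inj₂ e)) → d ≡ 1
    edgeCond v d d∣incident with position v
    ... | b , s , refl with edges-coprime b s
    ... | p , q , s∈p , s∈q , p⊥q = p⊥q (d∣label p s∈p , d∣label q s∈q)
      where
      d∣label : ∀ r → PairIncidentTo r s → d ∣ bladeLabel b (inj₂ r)
      d∣label r s∈r =
        subst (d ∣_) (label-bladeObject b (inj₂ r)) (d∣incident (bladeEdge b r) (bladeEdge-incident b r s∈r))

Coprime₆₀ : ℕ → ℕ → Set
Coprime₆₀ x y = Coprime x y × ∣ x - y ∣ ∣ 60

coprime₆₀? : ∀ x y → Dec (Coprime₆₀ x y)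
coprime₆₀? x y = coprime? x y ×-dec (∣ x - y ∣ ∣? 60)

coprime₆₀-translate : ∀ q {x y} → Coprime₆₀ x y → Coprime (60 * q + x) (60 * q + y)
coprime₆₀-translate q (x⊥y , ∣x-y∣∣60) = coprime-translate (60 * q) (∣-trans ∣x-y∣∣60 (m∣m*n q)) x⊥y

objectIndex : BladeObject 4 ↔ Fin 20
objectIndex = ↔-trans (⊎-cong ↔-refl (Pair↔Fin 6)) (↔-sym +↔⊎)

-- Row r serves the blades b ≡ r (mod 3): entry i is the slot, i.e. the label minus (20b + 2),
-- of the object with objectIndex i (outer vertices 0–4, then the edges in lexicographic order).
-- Found by computer search.
slotTable : Vec (Vec (Fin 20) 20) 3
slotTable =
  (# 3 ∷ # 5 ∷ # 6 ∷ # 7 ∷ # 9 ∷ # 17 ∷ # 11 ∷ # 14 ∷ # 8 ∷ # 0 ∷ # 19 ∷ # 4 ∷ # 18 ∷ # 12 ∷ # 16 ∷ # 13 ∷ # 10 ∷ # 1 ∷ # 15 ∷ # 2 ∷ []) ∷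
  (# 1 ∷ # 3 ∷ # 4 ∷ # 5 ∷ # 7 ∷ # 6 ∷ # 0 ∷ # 9 ∷ # 12 ∷ # 8 ∷ # 19 ∷ # 2 ∷ # 16 ∷ # 13 ∷ # 11 ∷ # 15 ∷ # 17 ∷ # 10 ∷ # 14 ∷ # 18 ∷ []) ∷
  (# 1 ∷ # 2 ∷ # 3 ∷ # 5 ∷ # 7 ∷ # 16 ∷ # 14 ∷ # 0 ∷ # 6 ∷ # 9 ∷ # 18 ∷ # 15 ∷ # 10 ∷ # 4 ∷ # 19 ∷ # 13 ∷ # 17 ∷ # 12 ∷ # 11 ∷ # 8 ∷ []) ∷ []

slotTable⁻¹ : Vec (Vec (Fin 20) 20) 3
slotTable⁻¹ =
  (# 9 ∷ # 17 ∷ # 19 ∷ # 0 ∷ # 11 ∷ # 1 ∷ # 2 ∷ # 3 ∷ # 8 ∷ # 4 ∷ # 16 ∷ # 6 ∷ # 13 ∷ # 15 ∷ # 7 ∷ # 18 ∷ # 14 ∷ # 5 ∷ # 12 ∷ # 10 ∷ []) ∷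
  (# 6 ∷ # 0 ∷ # 11 ∷ # 1 ∷ # 2 ∷ # 3 ∷ # 5 ∷ # 4 ∷ # 9 ∷ # 7 ∷ # 17 ∷ # 14 ∷ # 8 ∷ # 13 ∷ # 18 ∷ # 15 ∷ # 12 ∷ # 16 ∷ # 19 ∷ # 10 ∷ []) ∷
  (# 7 ∷ # 0 ∷ # 1 ∷ # 2 ∷ # 13 ∷ # 3 ∷ # 8 ∷ # 4 ∷ # 19 ∷ # 9 ∷ # 12 ∷ # 18 ∷ # 17 ∷ # 15 ∷ # 6 ∷ # 11 ∷ # 5 ∷ # 16 ∷ # 10 ∷ # 14 ∷ []) ∷ []

shuffle shuffle⁻¹ : Fin 3 → Fin 20 → Fin 20
shuffle   r = lookup (lookup slotTable r)
shuffle⁻¹ r = lookup (lookup slotTable⁻¹ r)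

shuffle-shuffle⁻¹ : ∀ r i → shuffle r (shuffle⁻¹ r i) ≡ i
shuffle-shuffle⁻¹ = toWitness {a? = all? λ r → all? λ i → shuffle r (shuffle⁻¹ r i) ≟ᶠ i} _

shuffle⁻¹-shuffle : ∀ r i → shuffle⁻¹ r (shuffle r i) ≡ i
shuffle⁻¹-shuffle = toWitness {a? = all? λ r → all? λ i → shuffle⁻¹ r (shuffle r i) ≟ᶠ i} _

slot : Fin 3 → BladeObject 4 ↔ Fin 20
slot r = ↔-trans objectIndex
  (permutation (shuffle r) (shuffle⁻¹ r) (shuffle-shuffle⁻¹ r) (shuffle⁻¹-shuffle r))

baseLabel : Fin 3 → BladeObject 4 → ℕ
baseLabel r o = 2 + (20 * toℕ r + toℕ (to (slot r) o))

pair : Fin 15 → Pair 6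
pair = from (Pair↔Fin 6)

baseLabel-vertices : ∀ r (u v : Fin 5) → u ≢ v → Coprime₆₀ (baseLabel r (inj₁ u)) (baseLabel r (inj₁ v))
baseLabel-vertices = toWitness
  {a? = all? λ r → all? λ u → all? λ v → ¬? (u ≟ᶠ v) →-dec coprime₆₀? (baseLabel r (inj₁ u)) (baseLabel r (inj₁ v))} _

baseLabel-edges : ∀ r (v : Fin 6) → ∃₂ λ i j → PairIncidentTo (pair i) v × PairIncidentTo (pair j) v ×
                  Coprime₆₀ (baseLabel r (inj₂ (pair i))) (baseLabel r (inj₂ (pair j)))
baseLabel-edges = toWitness
  {a? = all? λ r → all? λ v → any? λ i → any? λ j →
    pairIncidentTo? (pair i) v ×-dec pairIncidentTo? (pair j) v ×-dec
    coprime₆₀? (baseLabel r (inj₂ (pair i))) (baseLabel r (inj₂ (pair j)))} _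

windmillK₆-totalPrime : ∀ m → TotalPrime (windmill 4 (suc m))
windmillK₆-totalPrime m = windmill-totalPrime vertices edges
  where
  residue : Fin (suc m) → Fin 3
  residue b = toℕ b mod 3

  open BladeLabelling 4 m 20 (slot ∘ residue)

  rearrange : ∀ q r x → 2 + (20 * (r + q * 3) + x) ≡ 60 * q + (2 + (20 * r + x))
  rearrange = solve-∀

  bladeLabel-periodic : ∀ b o → bladeLabel b o ≡ 60 * (toℕ b / 3) + baseLabel (residue b) o
  bladeLabel-periodic b o =
    trans (cong (λ n → 2 + (20 * n + toℕ (to (slot (residue b)) o))) (DivMod.property (toℕ b divMod 3)))
          (rearrange (toℕ b / 3) (toℕ (residue b)) _)

  coprime-bladeLabel : ∀ b o o′ → Coprime₆₀ (baseLabel (residue b) o) (baseLabel (residue b) o′) →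
                       Coprime (bladeLabel b o) (bladeLabel b o′)
  coprime-bladeLabel b o o′ c =
    subst₂ Coprime (sym (bladeLabel-periodic b o)) (sym (bladeLabel-periodic b o′))
      (coprime₆₀-translate (toℕ b / 3) c)

  vertices : ∀ b {s t} → s ≢ t → Coprime (bladeLabel b (inj₁ s)) (bladeLabel b (inj₁ t))
  vertices b {s} {t} s≢t = coprime-bladeLabel b (inj₁ s) (inj₁ t) (baseLabel-vertices (residue b) s t s≢t)

  edges : ∀ b v → ∃₂ λ p q → PairIncidentTo p v × PairIncidentTo q v ×
                             Coprime (bladeLabel b (inj₂ p)) (bladeLabel b (inj₂ q))
  edges b v =
    let i , j , v∈i , v∈j , i⊥j = baseLabel-edges (residue b) v
    in  pair i , pair j , v∈i , v∈j , coprime-bladeLabel b (inj₂ (pair i)) (inj₂ (pair j)) i⊥j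

mainTheorem10 : ∀ (m : ℕ) → 2 ≤ m → TotalPrime (windmill 4 m)
mainTheorem10 zero    ()
mainTheorem10 (suc m) _  = windmillK₆-totalPrime m
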